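{- Let $N_1$ be a positive rational number and let $(X_1,Y_1)$ and $(Z_1,W_1)$ be rational points on the curve $C_{N_1}: y^2=x^3-N_1^2x$ with $Y_1\neq 0$, $W_1\neq 0$, $X_1\neq Z_1$, and such that $X_1Z_1$ is the square of a rational number; let $\sqrt{X_1Z_1}$ denote its positive square root. (i) For every positive rational number $d_s$, the numbers $$a=\frac{2N_1\sqrt{X_1Z_1}}{X_1Z_1+N_1^2}\,d_s,\quad b=\Big|\frac{X_1-Z_1}{X_1+Z_1}\Big|\,d_s,\quad c=\Big|\frac{2Y_1W_1}{(X_1Z_1+N_1^2)(X_1+Z_1)}\Big|\,d_s,$$ $$d_{ac}=\frac{2\sqrt{X_1Z_1}}{|X_1+Z_1|}\,d_s,\quad d_{bc}=\frac{|X_1Z_1-N_1^2|}{X_1Z_1+N_1^2}\,d_s$$ are positive rational numbers and $(a,b,c,d_{bc},d_{ac},d_s)$ is a nearly-perfect cuboid; its face diagonal $d_{ab}=\sqrt{a^2+b^2}$ equals $\sqrt{1-\Big(\frac{2Y_1W_1}{(X_1Z_1+N_1^2)(X_1+Z_1)}\Big)^2}\cdot d_s$. (ii) Conversely, every nearly-perfect cuboid is obtained in this way for some such $N_1$, $(X_1,Y_1)$, $(Z_1,W_1)$ and $d_s$. (iii) In particular, a perfect cuboid exists if and only if for some such data the number $\sqrt{1-\Big(\frac{2Y_1W_1}{(X_1Z_1+N_1^2)(X_1+Z_1)}\Big)^2}\cdot d_s$ is rational.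
   Context: For a nonzero rational $N$, the congruent number curve is $C_N: y^2=x^3-N^2x$; a rational point $(x,y)$ on it is called nontrivial if $y\neq 0$. A nearly-perfect cuboid (NPC) here means a sextuple of positive rational numbers $(a,b,c,d_{bc},d_{ac},d_s)$ with $b^2+c^2=d_{bc}^2$, $a^2+c^2=d_{ac}^2$, $a^2+b^2+c^2=d_s^2$ (the remaining face diagonal $d_{ab}=\sqrt{a^2+b^2}$ may be irrational). A perfect cuboid is a triple of positive rationals $a,b,c$ such that $a^2+b^2$, $b^2+c^2$, $a^2+c^2$ and $a^2+b^2+c^2$ are all squares of rational numbers. -}

module Defs where

open import Data.Rational using (ℚ; 0ℚ; 1ℚ; _+_; _*_; _-_; ∣_∣; _÷_; _<_; _≤_; ≢-nonZero)
open import Data.Rational.Properties using (_≟_)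
open import Data.Product using (_×_; ∃)
open import Relation.Binary.PropositionalEquality using (_≡_; _≢_)
open import Relation.Nullary using (yes; no)

-- Total division on ℚ (convention: p ⟋ 0 = 0). Only ever applied below to
-- denominators that are nonzero under the hypotheses of the theorem.
_⟋_ : ℚ → ℚ → ℚ
p ⟋ q with q ≟ 0ℚ
... | yes _ = 0ℚ
... | no q≢0 = _÷_ p q {{≢-nonZero q≢0}}

infixl 7 _⟋_

2ℚ : ℚ
2ℚ = 1ℚ + 1ℚ

OnCurve : ℚ → ℚ → ℚ → Set
OnCurve N x y = y * y ≡ x * x * x - N * N * x

ValidData : ℚ → ℚ → ℚ → ℚ → ℚ → ℚ → Set
ValidData N X Y Z W s =
  (0ℚ < N) × OnCurve N X Y × OnCurve N Z W × (Y ≢ 0ℚ) × (W ≢ 0ℚ) × (X ≢ Z)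
  × (0ℚ < s) × (s * s ≡ X * Z)

tval : ℚ → ℚ → ℚ → ℚ → ℚ → ℚ
tval N X Y Z W = (2ℚ * Y * W) ⟋ ((X * Z + N * N) * (X + Z))

aval bval cval dacval dbcval : ℚ → ℚ → ℚ → ℚ → ℚ → ℚ → ℚ → ℚ
aval   N X Y Z W s ds = ((2ℚ * N * s) ⟋ (X * Z + N * N)) * ds
bval   N X Y Z W s ds = ∣ (X - Z) ⟋ (X + Z) ∣ * ds
cval   N X Y Z W s ds = ∣ tval N X Y Z W ∣ * ds
dacval N X Y Z W s ds = ((2ℚ * s) ⟋ ∣ X + Z ∣) * ds
dbcval N X Y Z W s ds = (∣ X * Z - N * N ∣ ⟋ (X * Z + N * N)) * ds

NPC : ℚ → ℚ → ℚ → ℚ → ℚ → ℚ → Set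
NPC a b c dbc dac ds =
  (0ℚ < a) × (0ℚ < b) × (0ℚ < c) × (0ℚ < dbc) × (0ℚ < dac) × (0ℚ < ds)
  × (b * b + c * c ≡ dbc * dbc) × (a * a + c * c ≡ dac * dac)
  × (a * a + b * b + c * c ≡ ds * ds)

IsSquare : ℚ → Set
IsSquare q = ∃ λ r → r * r ≡ q

PerfectCuboid : ℚ → ℚ → ℚ → Set
PerfectCuboid a b c =
  (0ℚ < a) × (0ℚ < b) × (0ℚ < c)
  × IsSquare (a * a + b * b) × IsSquare (b * b + c * c)
  × IsSquare (a * a + c * c) × IsSquare (a * a + b * b + c * c)

{-# OPTIONS --safe #-}
-- Put D = X₁Z₁ + N₁², S = X₁ + Z₁ and s = √(X₁Z₁). The curve equations give
--   (2Y₁W₁)² = 4X₁Z₁(X₁² − N₁²)(Z₁² − N₁²) = (2sD)² − (2N₁sS)² = (X₁Z₁ − N₁²)²S² − (X₁ − Z₁)²D²,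
-- and (2s)² + (X₁ − Z₁)² = S². Dividing by (DS)² and S², the numbers α = 2N₁s/D, β = (X₁ − Z₁)/S,
-- t = 2Y₁W₁/(DS), δ = 2s/|S| and ε = |X₁Z₁ − N₁²|/D satisfy α² + t² = δ², β² + t² = ε² and
-- δ² + β² = 1, so (α, |β|, |t|, ε, δ, 1) is a nearly-perfect cuboid; scaling it by d_s gives (i),
-- with a² + b² = (1 − t²)d_s². Conversely, a cuboid has d_ac² = (d_s + b)(d_s − b) and
-- a² = (d_s + d_bc)(d_s − d_bc), which lets one write the curve data down as polynomials in
-- the edges; (iii) then follows from the formula for a² + b².
module Submission where

open import Defs
open import Data.Rational using (ℚ; 0ℚ; 1ℚ; _+_; _*_; _-_; _<_; _≤_)
open import Data.Product using (_×_; ∃)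
open import Function.Bundles using (_⇔_)
open import Relation.Binary.PropositionalEquality using (_≡_)

open import Data.Product using (_,_)
open import Data.Rational using (-_; ∣_∣; 1/_; ≢-nonZero; positive; nonNegative)
open import Data.Rational.Properties
open import Data.Empty using (⊥-elim)
open import Data.Sum using (inj₁; inj₂)
open import Function.Bundles using (mk⇔)
open import Level using (0ℓ)
open import Relation.Binary.PropositionalEquality
  using (_≢_; refl; sym; trans; cong; cong₂; subst; module ≡-Reasoning)
open import Relation.Nullary using (yes; no)
open import Relation.Nullary.Decidable using (dec⇒maybe)
open import Tactic.RingSolver using (solve-∀)
open import Algebra.Apartness.Properties.HeytingCommutativeRing heytingCommutativeRing
  using (x#0y#0→xy#0)
open import Algebra.Properties.Group +-0-group using (x∙y⁻¹≈ε⇒x≈y)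
import Tactic.RingSolver.Core.AlmostCommutativeRing as ACR

open ≡-Reasoning

ring : ACR.AlmostCommutativeRing 0ℓ 0ℓ
ring = ACR.fromCommutativeRing +-*-commutativeRing (λ x → dec⇒maybe (0ℚ ≟ x))

*-cancelʳ-≢0 : ∀ {x y} k → k ≢ 0ℚ → x * k ≡ y * k → x ≡ y
*-cancelʳ-≢0 {x} {y} k k≢0 xk≡yk = begin
  x                ≡⟨ sym (*-identityʳ x) ⟩
  x * 1ℚ           ≡⟨ cong (x *_) (sym (*-inverseʳ k)) ⟩
  x * (k * (1/ k)) ≡⟨ sym (*-assoc x k _) ⟩
  x * k * (1/ k)   ≡⟨ cong (_* (1/ k)) xk≡yk ⟩
  y * k * (1/ k)   ≡⟨ *-assoc y k _ ⟩
  y * (k * (1/ k)) ≡⟨ cong (y *_) (*-inverseʳ k) ⟩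
  y * 1ℚ           ≡⟨ *-identityʳ y ⟩
  y                ∎
  where instance _ = ≢-nonZero k≢0

+-*-cancelʳ-≢0 : ∀ u v w k → k ≢ 0ℚ → u * k + v * k ≡ w * k → u + v ≡ w
+-*-cancelʳ-≢0 u v w k k≢0 eq = *-cancelʳ-≢0 k k≢0 (trans (*-distribʳ-+ k u v) eq)

*-≢0 : ∀ {x y} → x ≢ 0ℚ → y ≢ 0ℚ → x * y ≢ 0ℚ
*-≢0 = x#0y#0→xy#0

⟋*-cancel : ∀ p {q} → q ≢ 0ℚ → (p ⟋ q) * q ≡ p
⟋*-cancel p {q} q≢0 with q ≟ 0ℚ
... | yes q≡0 = ⊥-elim (q≢0 q≡0)
... | no q≢0' = begin
  p * (1/ q) * q   ≡⟨ *-assoc p _ q ⟩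
  p * ((1/ q) * q) ≡⟨ cong (p *_) (*-inverseˡ q) ⟩
  p * 1ℚ           ≡⟨ *-identityʳ p ⟩
  p                ∎
  where instance _ = ≢-nonZero q≢0'

x*q≡p*d⇒x≡p⟋q*d : ∀ {x} p q d → q ≢ 0ℚ → x * q ≡ p * d → x ≡ (p ⟋ q) * d
x*q≡p*d⇒x≡p⟋q*d {x} p q d q≢0 eq = *-cancelʳ-≢0 q q≢0 (begin
  x * q           ≡⟨ eq ⟩
  p * d           ≡⟨ cong (_* d) (sym (⟋*-cancel p q≢0)) ⟩
  (p ⟋ q) * q * d ≡⟨ *-swapʳ (p ⟋ q) q d ⟩
  (p ⟋ q) * d * q ∎)
  where
  *-swapʳ : ∀ x y z → x * y * z ≡ x * z * y
  *-swapʳ = solve-∀ ring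

⟋-≢0 : ∀ {p q} → p ≢ 0ℚ → q ≢ 0ℚ → p ⟋ q ≢ 0ℚ
⟋-≢0 {p} {q} p≢0 q≢0 p⟋q≡0 = p≢0 (begin
  p               ≡⟨ sym (⟋*-cancel p q≢0) ⟩
  (p ⟋ q) * q     ≡⟨ cong (_* q) p⟋q≡0 ⟩
  0ℚ * q          ≡⟨ *-zeroˡ q ⟩
  0ℚ              ∎)

square-distrib : ∀ x y → (x * y) * (x * y) ≡ x * x * (y * y)
square-distrib = solve-∀ ring

⟋-square : ∀ p {q} → q ≢ 0ℚ → (p ⟋ q) * (p ⟋ q) * (q * q) ≡ p * p
⟋-square p {q} q≢0 = trans (sym (square-distrib (p ⟋ q) q)) (cong (λ u → u * u) (⟋*-cancel p q≢0))

∣x∣*∣x∣≡x*x : ∀ x → ∣ x ∣ * ∣ x ∣ ≡ x * x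
∣x∣*∣x∣≡x*x x with ∣p∣≡p∨∣p∣≡-p x
... | inj₁ ∣x∣≡x  rewrite ∣x∣≡x  = refl
... | inj₂ ∣x∣≡-x rewrite ∣x∣≡-x = neg-square x
  where
  neg-square : ∀ x → (- x) * (- x) ≡ x * x
  neg-square = solve-∀ ring

⟋∣∣-square : ∀ p {q} → q ≢ 0ℚ → (p ⟋ ∣ q ∣) * (p ⟋ ∣ q ∣) * (q * q) ≡ p * p
⟋∣∣-square p {q} q≢0 = trans (cong ((p ⟋ ∣ q ∣) * (p ⟋ ∣ q ∣) *_) (sym (∣x∣*∣x∣≡x*x q)))
  (⟋-square p (λ ∣q∣≡0 → q≢0 (∣p∣≡0⇒p≡0 q ∣q∣≡0)))

<⇒≢0 : ∀ {x} → 0ℚ < x → x ≢ 0ℚ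
<⇒≢0 0<x x≡0 = <-irrefl (sym x≡0) 0<x

≤∧≢0⇒< : ∀ {x} → 0ℚ ≤ x → x ≢ 0ℚ → 0ℚ < x
≤∧≢0⇒< {x} 0≤x x≢0 = positive⁻¹ x {{nonNeg∧nonZero⇒pos x {{nonNegative 0≤x}} {{≢-nonZero x≢0}}}}

*-pos : ∀ {x y} → 0ℚ < x → 0ℚ < y → 0ℚ < x * y
*-pos {x} {y} 0<x 0<y = positive⁻¹ (x * y) {{pos*pos⇒pos x {{positive 0<x}} y {{positive 0<y}}}}

*-nonNeg : ∀ {x y} → 0ℚ ≤ x → 0ℚ ≤ y → 0ℚ ≤ x * y
*-nonNeg {x} {y} 0≤x 0≤y =
  nonNegative⁻¹ (x * y) {{nonNeg*nonNeg⇒nonNeg x {{nonNegative 0≤x}} y {{nonNegative 0≤y}}}}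

+-pos : ∀ {x y} → 0ℚ < x → 0ℚ ≤ y → 0ℚ < x + y
+-pos {x} {y} 0<x 0≤y = positive⁻¹ (x + y) {{pos+nonNeg⇒pos x {{positive 0<x}} y {{nonNegative 0≤y}}}}

+-nonNeg : ∀ {x y} → 0ℚ ≤ x → 0ℚ ≤ y → 0ℚ ≤ x + y
+-nonNeg {x} {y} 0≤x 0≤y = subst (_≤ x + y) (+-identityʳ 0ℚ) (+-mono-≤ 0≤x 0≤y)

*-pos⇒pos : ∀ {x y} → 0ℚ < y → 0ℚ < x * y → 0ℚ < x
*-pos⇒pos {x} {y} 0<y 0<xy =
  *-cancelʳ-<-nonNeg y {{nonNegative (<⇒≤ 0<y)}} (subst (_< x * y) (sym (*-zeroˡ y)) 0<xy)

⟋-pos : ∀ {p q} → 0ℚ < p → 0ℚ < q → 0ℚ < p ⟋ q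
⟋-pos {p} {q} 0<p 0<q = *-pos⇒pos 0<q (subst (0ℚ <_) (sym (⟋*-cancel p (<⇒≢0 0<q))) 0<p)

⟋-nonNeg : ∀ {p q} → 0ℚ ≤ p → 0ℚ < q → 0ℚ ≤ p ⟋ q
⟋-nonNeg {p} {q} 0≤p 0<q with q ≟ 0ℚ
... | yes q≡0 = ⊥-elim (<⇒≢0 0<q q≡0)
... | no _    = *-nonNeg 0≤p (<⇒≤ (positive⁻¹ _ {{1/pos⇒pos q {{positive 0<q}}}}))

0≤x*x : ∀ x → 0ℚ ≤ x * x
0≤x*x x = subst (0ℚ ≤_) (∣x∣*∣x∣≡x*x x) (*-nonNeg (0≤∣p∣ x) (0≤∣p∣ x))

0<∣x∣ : ∀ {x} → x ≢ 0ℚ → 0ℚ < ∣ x ∣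
0<∣x∣ {x} x≢0 = ≤∧≢0⇒< (0≤∣p∣ x) (λ ∣x∣≡0 → x≢0 (∣p∣≡0⇒p≡0 x ∣x∣≡0))

0<x*x : ∀ {x} → x ≢ 0ℚ → 0ℚ < x * x
0<x*x {x} x≢0 = subst (0ℚ <_) (∣x∣*∣x∣≡x*x x) (*-pos (0<∣x∣ x≢0) (0<∣x∣ x≢0))

0<2 : 0ℚ < 2ℚ
0<2 = positive⁻¹ 2ℚ

x*q≡p*d⇒x≡∣p⟋q∣*d : ∀ {x} p q d → 0ℚ ≤ p → 0ℚ < q → x * q ≡ p * d → x ≡ ∣ p ⟋ q ∣ * d
x*q≡p*d⇒x≡∣p⟋q∣*d p q d 0≤p 0<q eq = trans (x*q≡p*d⇒x≡p⟋q*d p q d (<⇒≢0 0<q) eq)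
  (cong (_* d) (sym (0≤p⇒∣p∣≡p (⟋-nonNeg 0≤p 0<q))))

+≡⇒≡- : ∀ {x y z} → x + y ≡ z → x ≡ z - y
+≡⇒≡- {x} {y} {z} x+y≡z = trans (x≡[x+y]-y x y) (cong (_- y) x+y≡z)
  where
  x≡[x+y]-y : ∀ x y → x ≡ (x + y) - y
  x≡[x+y]-y = solve-∀ ring

+-swapʳ : ∀ x y z → x + y + z ≡ x + z + y
+-swapʳ = solve-∀ ring

difference-of-squares : ∀ x y → x * x - y * y ≡ (x + y) * (x - y)
difference-of-squares = solve-∀ ring

triple-square : ∀ x y z → (x * y * z) * (x * y * z) ≡ x * x * (y * y) * (z * z)
triple-square = solve-∀ ring

sum-of-squares-cleared : ∀ x y z {P Q R} K → K ≢ 0ℚ →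
  x * x * K ≡ P → y * y * K ≡ Q → z * z * K ≡ R → P + Q ≡ R → x * x + y * y ≡ z * z
sum-of-squares-cleared x y z K K≢0 xxK≡P yyK≡Q zzK≡R P+Q≡R =
  +-*-cancelʳ-≢0 (x * x) (y * y) (z * z) K K≢0 (trans (cong₂ _+_ xxK≡P yyK≡Q) (trans P+Q≡R (sym zzK≡R)))

square-regroupʳ : ∀ x q r → x * x * ((q * r) * (q * r)) ≡ x * x * (q * q) * (r * r)
square-regroupʳ = solve-∀ ring

square-regroupˡ : ∀ x q r → x * x * ((r * q) * (r * q)) ≡ x * x * (q * q) * (r * r)
square-regroupˡ = solve-∀ ring

NPC⇒a²+b²≡d²-c² : ∀ {a b c dbc dac d} → NPC a b c dbc dac d → a * a + b * b ≡ d * d - c * c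
NPC⇒a²+b²≡d²-c² (_ , _ , _ , _ , _ , _ , _ , _ , abc) = +≡⇒≡- abc

square-sum-scale : ∀ x y d → (x * d) * (x * d) + (y * d) * (y * d) ≡ (x * x + y * y) * (d * d)
square-sum-scale = solve-∀ ring

square-sum₃-scale : ∀ x y z d →
  (x * d) * (x * d) + (y * d) * (y * d) + (z * d) * (z * d) ≡ (x * x + y * y + z * z) * (d * d)
square-sum₃-scale = solve-∀ ring

NPC-scale : ∀ {a b c dbc dac d} → NPC a b c dbc dac 1ℚ → 0ℚ < d →
  NPC (a * d) (b * d) (c * d) (dbc * d) (dac * d) d
NPC-scale {a} {b} {c} {dbc} {dac} {d} (0<a , 0<b , 0<c , 0<dbc , 0<dac , _ , bc , ac , abc) 0<d =
  *-pos 0<a 0<d , *-pos 0<b 0<d , *-pos 0<c 0<d , *-pos 0<dbc 0<d , *-pos 0<dac 0<d , 0<d ,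
  scaled b c dbc bc , scaled a c dac ac , (begin
    (a * d) * (a * d) + (b * d) * (b * d) + (c * d) * (c * d) ≡⟨ square-sum₃-scale a b c d ⟩
    (a * a + b * b + c * c) * (d * d)                         ≡⟨ cong (_* (d * d)) abc ⟩
    1ℚ * 1ℚ * (d * d)                                         ≡⟨ cong (_* (d * d)) (*-identityˡ 1ℚ) ⟩
    1ℚ * (d * d)                                              ≡⟨ *-identityˡ (d * d) ⟩
    d * d                                                     ∎)
  where
  scaled : ∀ x y z → x * x + y * y ≡ z * z → (x * d) * (x * d) + (y * d) * (y * d) ≡ (z * d) * (z * d)
  scaled x y z eq = begin
    (x * d) * (x * d) + (y * d) * (y * d) ≡⟨ square-sum-scale x y d ⟩
    (x * x + y * y) * (d * d)             ≡⟨ cong (_* (d * d)) eq ⟩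
    z * z * (d * d)                       ≡⟨ sym (square-distrib z d) ⟩
    (z * d) * (z * d)                     ∎

module FromCurve {N X Y Z W s : ℚ}
  (0<N : 0ℚ < N) (onX : OnCurve N X Y) (onZ : OnCurve N Z W)
  (Y≢0 : Y ≢ 0ℚ) (W≢0 : W ≢ 0ℚ) (X≢Z : X ≢ Z) (0<s : 0ℚ < s) (s²≡XZ : s * s ≡ X * Z)
  where

  D S α β t δ ε : ℚ
  D = X * Z + N * N
  S = X + Z
  α = (2ℚ * N * s) ⟋ D
  β = (X - Z) ⟋ S
  t = tval N X Y Z W
  δ = (2ℚ * s) ⟋ ∣ S ∣
  ε = ∣ X * Z - N * N ∣ ⟋ D

  [2s]²≡4XZ : (2ℚ * s) * (2ℚ * s) ≡ 2ℚ * 2ℚ * (X * Z)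
  [2s]²≡4XZ = trans (square-distrib 2ℚ s) (cong (2ℚ * 2ℚ *_) s²≡XZ)

  [2YW]²≡4[X³-N²X][Z³-N²Z] :
    (2ℚ * Y * W) * (2ℚ * Y * W) ≡ 2ℚ * 2ℚ * ((X * X * X - N * N * X) * (Z * Z * Z - N * N * Z))
  [2YW]²≡4[X³-N²X][Z³-N²Z] = trans (regroup Y W) (cong (2ℚ * 2ℚ *_) (cong₂ _*_ onX onZ))
    where
    regroup : ∀ Y W → (2ℚ * Y * W) * (2ℚ * Y * W) ≡ 2ℚ * 2ℚ * ((Y * Y) * (W * W))
    regroup = solve-∀ ring

  ac-identity : (2ℚ * N * s) * (2ℚ * N * s) * (S * S) + (2ℚ * Y * W) * (2ℚ * Y * W)
              ≡ (2ℚ * s) * (2ℚ * s) * (D * D)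
  ac-identity = begin
    (2ℚ * N * s) * (2ℚ * N * s) * (S * S) + (2ℚ * Y * W) * (2ℚ * Y * W)
      ≡⟨ cong₂ (λ u v → u * (S * S) + v) [2Ns]²≡4N²XZ [2YW]²≡4[X³-N²X][Z³-N²Z] ⟩
    (2ℚ * N) * (2ℚ * N) * (X * Z) * (S * S) + 2ℚ * 2ℚ * ((X * X * X - N * N * X) * (Z * Z * Z - N * N * Z))
      ≡⟨ polynomial N X Z ⟩
    2ℚ * 2ℚ * (X * Z) * (D * D)
      ≡⟨ cong (_* (D * D)) (sym [2s]²≡4XZ) ⟩
    (2ℚ * s) * (2ℚ * s) * (D * D) ∎
    where
    [2Ns]²≡4N²XZ : (2ℚ * N * s) * (2ℚ * N * s) ≡ (2ℚ * N) * (2ℚ * N) * (X * Z)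
    [2Ns]²≡4N²XZ = trans (square-distrib (2ℚ * N) s) (cong ((2ℚ * N) * (2ℚ * N) *_) s²≡XZ)
    polynomial : ∀ N X Z →
      (2ℚ * N) * (2ℚ * N) * (X * Z) * ((X + Z) * (X + Z))
        + 2ℚ * 2ℚ * ((X * X * X - N * N * X) * (Z * Z * Z - N * N * Z))
      ≡ 2ℚ * 2ℚ * (X * Z) * ((X * Z + N * N) * (X * Z + N * N))
    polynomial = solve-∀ ring

  bc-identity : (X - Z) * (X - Z) * (D * D) + (2ℚ * Y * W) * (2ℚ * Y * W)
              ≡ (X * Z - N * N) * (X * Z - N * N) * (S * S)
  bc-identity = trans (cong ((X - Z) * (X - Z) * (D * D) +_) [2YW]²≡4[X³-N²X][Z³-N²Z]) (polynomial N X Z)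
    where
    polynomial : ∀ N X Z →
      (X - Z) * (X - Z) * ((X * Z + N * N) * (X * Z + N * N))
        + 2ℚ * 2ℚ * ((X * X * X - N * N * X) * (Z * Z * Z - N * N * Z))
      ≡ (X * Z - N * N) * (X * Z - N * N) * ((X + Z) * (X + Z))
    polynomial = solve-∀ ring

  diagonal-identity : (2ℚ * s) * (2ℚ * s) + (X - Z) * (X - Z) ≡ S * S
  diagonal-identity = trans (cong (_+ (X - Z) * (X - Z)) [2s]²≡4XZ) (polynomial X Z)
    where
    polynomial : ∀ X Z → 2ℚ * 2ℚ * (X * Z) + (X - Z) * (X - Z) ≡ (X + Z) * (X + Z)
    polynomial = solve-∀ ring

  0<D : 0ℚ < D
  0<D = subst (λ u → 0ℚ < u + N * N) s²≡XZ (+-pos (*-pos 0<s 0<s) (0≤x*x N))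

  S≢0 : S ≢ 0ℚ
  S≢0 S≡0 = <⇒≢0 (+-pos (*-pos 0<s 0<s) (0≤x*x X)) (begin
    s * s + X * X ≡⟨ +-comm (s * s) (X * X) ⟩
    X * X + s * s ≡⟨ cong (X * X +_) s²≡XZ ⟩
    X * X + X * Z ≡⟨ sym (*-distribˡ-+ X X Z) ⟩
    X * S         ≡⟨ cong (X *_) S≡0 ⟩
    X * 0ℚ        ≡⟨ *-zeroʳ X ⟩
    0ℚ            ∎)

  D≢0 : D ≢ 0ℚ
  D≢0 = <⇒≢0 0<D

  DS≢0 : D * S ≢ 0ℚ
  DS≢0 = *-≢0 D≢0 S≢0

  α²+t²≡δ² : α * α + t * t ≡ δ * δ
  α²+t²≡δ² = sum-of-squares-cleared α t δ ((D * S) * (D * S)) (*-≢0 DS≢0 DS≢0)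
    (trans (square-regroupʳ α D S) (cong (_* (S * S)) (⟋-square (2ℚ * N * s) D≢0)))
    (⟋-square (2ℚ * Y * W) DS≢0)
    (trans (square-regroupˡ δ S D) (cong (_* (D * D)) (⟋∣∣-square (2ℚ * s) S≢0)))
    ac-identity

  β²+t²≡ε² : β * β + t * t ≡ ε * ε
  β²+t²≡ε² = sum-of-squares-cleared β t ε ((D * S) * (D * S)) (*-≢0 DS≢0 DS≢0)
    (trans (square-regroupˡ β S D) (cong (_* (D * D)) (⟋-square (X - Z) S≢0)))
    (⟋-square (2ℚ * Y * W) DS≢0)
    (trans (square-regroupʳ ε D S)
      (cong (_* (S * S)) (trans (⟋-square ∣ X * Z - N * N ∣ D≢0) (∣x∣*∣x∣≡x*x (X * Z - N * N)))))
    bc-identity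

  δ²+β²≡1 : δ * δ + β * β ≡ 1ℚ * 1ℚ
  δ²+β²≡1 = sum-of-squares-cleared δ β 1ℚ (S * S) (*-≢0 S≢0 S≢0)
    (⟋∣∣-square (2ℚ * s) S≢0)
    (⟋-square (X - Z) S≢0)
    (trans (cong (_* (S * S)) (*-identityˡ 1ℚ)) (*-identityˡ (S * S)))
    diagonal-identity

  unit-NPC : NPC α ∣ β ∣ ∣ t ∣ ε δ 1ℚ
  unit-NPC = 0<α , 0<∣x∣ β≢0 , 0<∣x∣ t≢0 , 0<ε , 0<δ , positive⁻¹ 1ℚ ,
    trans (cong₂ _+_ (∣x∣*∣x∣≡x*x β) (∣x∣*∣x∣≡x*x t)) β²+t²≡ε² ,
    trans (cong (α * α +_) (∣x∣*∣x∣≡x*x t)) α²+t²≡δ² ,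
    (begin
      α * α + ∣ β ∣ * ∣ β ∣ + ∣ t ∣ * ∣ t ∣
        ≡⟨ cong₂ (λ u v → α * α + u + v) (∣x∣*∣x∣≡x*x β) (∣x∣*∣x∣≡x*x t) ⟩
      α * α + β * β + t * t ≡⟨ +-swapʳ (α * α) (β * β) (t * t) ⟩
      α * α + t * t + β * β ≡⟨ cong (_+ β * β) α²+t²≡δ² ⟩
      δ * δ + β * β         ≡⟨ δ²+β²≡1 ⟩
      1ℚ * 1ℚ               ∎)
    where
    β≢0 : β ≢ 0ℚ
    β≢0 = ⟋-≢0 (λ X-Z≡0 → X≢Z (x∙y⁻¹≈ε⇒x≈y X Z X-Z≡0)) S≢0

    t≢0 : t ≢ 0ℚ
    t≢0 = ⟋-≢0 (*-≢0 (*-≢0 (<⇒≢0 0<2) Y≢0) W≢0) DS≢0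

    0<α : 0ℚ < α
    0<α = ⟋-pos (*-pos (*-pos 0<2 0<N) 0<s) 0<D

    0<δ : 0ℚ < δ
    0<δ = ⟋-pos (*-pos 0<2 0<s) (0<∣x∣ S≢0)

    0<ε² : 0ℚ < ε * ε
    0<ε² = subst (0ℚ <_) (trans (+-comm (t * t) (β * β)) β²+t²≡ε²) (+-pos (0<x*x t≢0) (0≤x*x β))

    0<ε : 0ℚ < ε
    0<ε = ≤∧≢0⇒< (⟋-nonNeg (0≤∣p∣ _) 0<D)
      (λ ε≡0 → <⇒≢0 0<ε² (trans (cong (λ u → u * u) ε≡0) (*-zeroˡ 0ℚ)))

  α²+∣β∣²≡1-t² : α * α + ∣ β ∣ * ∣ β ∣ ≡ 1ℚ - t * t
  α²+∣β∣²≡1-t² = trans (NPC⇒a²+b²≡d²-c² unit-NPC) (cong₂ _-_ (*-identityˡ 1ℚ) (∣x∣*∣x∣≡x*x t))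

  scaled-cuboid : ∀ {ds} → 0ℚ < ds →
    NPC (α * ds) (∣ β ∣ * ds) (∣ t ∣ * ds) (ε * ds) (δ * ds) ds
    × (0ℚ ≤ 1ℚ - t * t)
    × ((α * ds) * (α * ds) + (∣ β ∣ * ds) * (∣ β ∣ * ds) ≡ (1ℚ - t * t) * (ds * ds))
  scaled-cuboid {ds} 0<ds =
    NPC-scale unit-NPC 0<ds ,
    subst (0ℚ ≤_) α²+∣β∣²≡1-t² (+-nonNeg (0≤x*x α) (0≤x*x ∣ β ∣)) ,
    trans (square-sum-scale α ∣ β ∣ ds) (cong (_* (ds * ds)) α²+∣β∣²≡1-t²)

curve⇒cuboid : ∀ {N X Y Z W s ds} → ValidData N X Y Z W s → 0ℚ < ds →
  let a = aval N X Y Z W s ds ; b = bval N X Y Z W s ds ; t = tval N X Y Z W in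
  NPC a b (cval N X Y Z W s ds) (dbcval N X Y Z W s ds) (dacval N X Y Z W s ds) ds
  × (0ℚ ≤ 1ℚ - t * t)
  × (a * a + b * b ≡ (1ℚ - t * t) * (ds * ds))
curve⇒cuboid (0<N , onX , onZ , Y≢0 , W≢0 , X≢Z , 0<s , s²≡XZ) =
  FromCurve.scaled-cuboid 0<N onX onZ Y≢0 W≢0 X≢Z 0<s s²≡XZ

onCurve-scaled : ∀ N k x y u v w → N * N ≡ k * k * (x * y) * (u * v) → k * (x * u - y * v) ≡ w * w →
  OnCurve N (k * x * u) (k * x * u * w)
onCurve-scaled N k x y u v w N²≡k²xyuv k[xu-yv]≡w² = sym (begin
  X * X * X - N * N * X                     ≡⟨ cong (λ M → X * X * X - M * X) N²≡k²xyuv ⟩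
  X * X * X - k * k * (x * y) * (u * v) * X ≡⟨ factor k x y u v ⟩
  X * X * (k * (x * u - y * v))             ≡⟨ cong (X * X *_) k[xu-yv]≡w² ⟩
  X * X * (w * w)                           ≡⟨ sym (square-distrib X w) ⟩
  (X * w) * (X * w)                         ∎)
  where
  X = k * x * u
  factor : ∀ k x y u v →
    (k * x * u) * (k * x * u) * (k * x * u) - k * k * (x * y) * (u * v) * (k * x * u)
    ≡ (k * x * u) * (k * x * u) * (k * (x * u - y * v))
  factor = solve-∀ ring

module FromNPC {a b c dbc dac ds : ℚ}
  (0<a : 0ℚ < a) (0<b : 0ℚ < b) (0<c : 0ℚ < c) (0<dbc : 0ℚ < dbc) (0<dac : 0ℚ < dac) (0<ds : 0ℚ < ds)
  (bc : b * b + c * c ≡ dbc * dbc) (ac : a * a + c * c ≡ dac * dac) (abc : a * a + b * b + c * c ≡ ds * ds)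
  where

  p m P n k X Z s N Y W D : ℚ
  p = ds + b
  m = ds - b
  P = ds + dbc
  n = ds - dbc
  -- k = pP − mn, which makes X(X² − N²) = (Xk)² a square.
  k = 2ℚ * ds * (b + dbc)
  X = k * p * P
  Z = k * m * P
  s = k * dac * P
  N = k * dac * a
  Y = X * k
  W = Z * (2ℚ * ds * c)
  D = X * Z + N * N

  dac²≡pm : dac * dac ≡ p * m
  dac²≡pm = trans (+≡⇒≡- (begin
    dac * dac + b * b     ≡⟨ cong (_+ b * b) (sym ac) ⟩
    a * a + c * c + b * b ≡⟨ +-swapʳ (a * a) (c * c) (b * b) ⟩
    a * a + b * b + c * c ≡⟨ abc ⟩
    ds * ds               ∎)) (difference-of-squares ds b)

  a²≡Pn : a * a ≡ P * n
  a²≡Pn = trans (+≡⇒≡- (begin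
    a * a + dbc * dbc       ≡⟨ cong (a * a +_) (sym bc) ⟩
    a * a + (b * b + c * c) ≡⟨ sym (+-assoc (a * a) (b * b) (c * c)) ⟩
    a * a + b * b + c * c   ≡⟨ abc ⟩
    ds * ds                 ∎)) (difference-of-squares ds dbc)

  N²≡k²pmPn : N * N ≡ k * k * (p * m) * (P * n)
  N²≡k²pmPn = trans (triple-square k dac a) (cong₂ (λ u v → k * k * u * v) dac²≡pm a²≡Pn)

  onCurve-X : OnCurve N X Y
  onCurve-X = onCurve-scaled N k p m P n k N²≡k²pmPn (cong (k *_) (pP-mn≡k ds b dbc))
    where
    pP-mn≡k : ∀ ds b dbc → (ds + b) * (ds + dbc) - (ds - b) * (ds - dbc) ≡ 2ℚ * ds * (b + dbc)
    pP-mn≡k = solve-∀ ring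

  onCurve-Z : OnCurve N Z W
  onCurve-Z = onCurve-scaled N k m p P n (2ℚ * ds * c)
    (trans N²≡k²pmPn (cong (λ u → k * k * u * (P * n)) (*-comm p m)))
    (begin
      k * (m * P - p * n)
        ≡⟨ expand ds b dbc ⟩
      (2ℚ * ds) * (2ℚ * ds) * (dbc * dbc - b * b)
        ≡⟨ cong ((2ℚ * ds) * (2ℚ * ds) *_) (sym c²≡dbc²-b²) ⟩
      (2ℚ * ds) * (2ℚ * ds) * (c * c)
        ≡⟨ sym (square-distrib (2ℚ * ds) c) ⟩
      (2ℚ * ds * c) * (2ℚ * ds * c) ∎)
    where
    c²≡dbc²-b² : c * c ≡ dbc * dbc - b * b
    c²≡dbc²-b² = +≡⇒≡- (trans (+-comm (c * c) (b * b)) bc)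
    expand : ∀ ds b dbc →
      2ℚ * ds * (b + dbc) * ((ds - b) * (ds + dbc) - (ds + b) * (ds - dbc))
      ≡ (2ℚ * ds) * (2ℚ * ds) * (dbc * dbc - b * b)
    expand = solve-∀ ring

  s²≡XZ : s * s ≡ X * Z
  s²≡XZ = begin
    s * s                         ≡⟨ triple-square k dac P ⟩
    k * k * (dac * dac) * (P * P) ≡⟨ cong (λ u → k * k * u * (P * P)) dac²≡pm ⟩
    k * k * (p * m) * (P * P)     ≡⟨ regroup k p m P ⟩
    X * Z                         ∎
    where
    regroup : ∀ k p m P → k * k * (p * m) * (P * P) ≡ (k * p * P) * (k * m * P)
    regroup = solve-∀ ring

  D≡k²pmP[2ds] : D ≡ k * k * (p * m) * P * (2ℚ * ds)
  D≡k²pmP[2ds] = trans (cong (X * Z +_) N²≡k²pmPn) (factor k p m ds dbc)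
    where
    factor : ∀ k p m ds dbc →
      (k * p * (ds + dbc)) * (k * m * (ds + dbc)) + k * k * (p * m) * ((ds + dbc) * (ds - dbc))
      ≡ k * k * (p * m) * (ds + dbc) * (2ℚ * ds)
    factor = solve-∀ ring

  XZ-N²≡k²pmP[2dbc] : X * Z - N * N ≡ k * k * (p * m) * P * (2ℚ * dbc)
  XZ-N²≡k²pmP[2dbc] = trans (cong (λ M → X * Z - M) N²≡k²pmPn) (factor k p m ds dbc)
    where
    factor : ∀ k p m ds dbc →
      (k * p * (ds + dbc)) * (k * m * (ds + dbc)) - k * k * (p * m) * ((ds + dbc) * (ds - dbc))
      ≡ k * k * (p * m) * (ds + dbc) * (2ℚ * dbc)
    factor = solve-∀ ring

  X-Z≡kP[2b] : X - Z ≡ k * P * (2ℚ * b)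
  X-Z≡kP[2b] = factor k ds b P
    where
    factor : ∀ k ds b P → k * (ds + b) * P - k * (ds - b) * P ≡ k * P * (2ℚ * b)
    factor = solve-∀ ring

  0<p : 0ℚ < p
  0<p = +-pos 0<ds (<⇒≤ 0<b)

  0<m : 0ℚ < m
  0<m = *-pos⇒pos 0<p (subst (0ℚ <_) (trans dac²≡pm (*-comm p m)) (*-pos 0<dac 0<dac))

  0<P : 0ℚ < P
  0<P = +-pos 0<ds (<⇒≤ 0<dbc)

  0<k : 0ℚ < k
  0<k = *-pos (*-pos 0<2 0<ds) (+-pos 0<b (<⇒≤ 0<dbc))

  0<X : 0ℚ < X
  0<X = *-pos (*-pos 0<k 0<p) 0<P

  0<Z : 0ℚ < Z
  0<Z = *-pos (*-pos 0<k 0<m) 0<P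

  0<Y : 0ℚ < Y
  0<Y = *-pos 0<X 0<k

  0<W : 0ℚ < W
  0<W = *-pos 0<Z (*-pos (*-pos 0<2 0<ds) 0<c)

  0<X+Z : 0ℚ < X + Z
  0<X+Z = +-pos 0<X (<⇒≤ 0<Z)

  0<X-Z : 0ℚ < X - Z
  0<X-Z = subst (0ℚ <_) (sym X-Z≡kP[2b]) (*-pos (*-pos 0<k 0<P) (*-pos 0<2 0<b))

  0<k²pmP : 0ℚ < k * k * (p * m) * P
  0<k²pmP = *-pos (*-pos (*-pos 0<k 0<k) (*-pos 0<p 0<m)) 0<P

  0<D : 0ℚ < D
  0<D = subst (0ℚ <_) (sym D≡k²pmP[2ds]) (*-pos 0<k²pmP (*-pos 0<2 0<ds))

  valid : ValidData N X Y Z W s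
  valid = *-pos (*-pos 0<k 0<dac) 0<a , onCurve-X , onCurve-Z , <⇒≢0 0<Y , <⇒≢0 0<W ,
    (λ X≡Z → <⇒≢0 0<X-Z (trans (cong (_- Z) X≡Z) (+-inverseʳ Z))) ,
    *-pos (*-pos 0<k 0<dac) 0<P , s²≡XZ

  a≡aval : a ≡ aval N X Y Z W s ds
  a≡aval = x*q≡p*d⇒x≡p⟋q*d (2ℚ * N * s) D ds (<⇒≢0 0<D) (begin
    a * D                                     ≡⟨ cong (a *_) D≡k²pmP[2ds] ⟩
    a * (k * k * (p * m) * P * (2ℚ * ds))     ≡⟨ cong (λ u → a * (k * k * u * P * (2ℚ * ds))) (sym dac²≡pm) ⟩
    a * (k * k * (dac * dac) * P * (2ℚ * ds)) ≡⟨ regroup k dac a P ds ⟩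
    2ℚ * N * s * ds                           ∎)
    where
    regroup : ∀ k d a P ds → a * (k * k * (d * d) * P * (2ℚ * ds)) ≡ 2ℚ * (k * d * a) * (k * d * P) * ds
    regroup = solve-∀ ring

  b≡bval : b ≡ bval N X Y Z W s ds
  b≡bval = x*q≡p*d⇒x≡∣p⟋q∣*d (X - Z) (X + Z) ds (<⇒≤ 0<X-Z) 0<X+Z (identity k ds b P)
    where
    identity : ∀ k ds b P → b * (k * (ds + b) * P + k * (ds - b) * P) ≡ (k * (ds + b) * P - k * (ds - b) * P) * ds
    identity = solve-∀ ring

  c≡cval : c ≡ cval N X Y Z W s ds
  c≡cval = x*q≡p*d⇒x≡∣p⟋q∣*d (2ℚ * Y * W) (D * (X + Z)) ds
    (<⇒≤ (*-pos (*-pos 0<2 0<Y) 0<W))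
    (*-pos 0<D 0<X+Z)
    (begin
      c * (D * (X + Z))                                   ≡⟨ cong (λ u → c * (u * (X + Z))) D≡k²pmP[2ds] ⟩
      c * (k * k * (p * m) * P * (2ℚ * ds) * (X + Z))     ≡⟨ identity k ds b P c ⟩
      2ℚ * Y * W * ds                                     ∎)
    where
    identity : ∀ k ds b P c →
      c * (k * k * ((ds + b) * (ds - b)) * P * (2ℚ * ds) * (k * (ds + b) * P + k * (ds - b) * P))
      ≡ 2ℚ * (k * (ds + b) * P * k) * (k * (ds - b) * P * (2ℚ * ds * c)) * ds
    identity = solve-∀ ring

  dbc≡dbcval : dbc ≡ dbcval N X Y Z W s ds
  dbc≡dbcval = trans (x*q≡p*d⇒x≡p⟋q*d (X * Z - N * N) D ds (<⇒≢0 0<D) (begin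
      dbc * D                                   ≡⟨ cong (dbc *_) D≡k²pmP[2ds] ⟩
      dbc * (k * k * (p * m) * P * (2ℚ * ds))   ≡⟨ swap (k * k * (p * m) * P) ds dbc ⟩
      k * k * (p * m) * P * (2ℚ * dbc) * ds     ≡⟨ cong (_* ds) (sym XZ-N²≡k²pmP[2dbc]) ⟩
      (X * Z - N * N) * ds                      ∎))
    (cong (λ u → (u ⟋ D) * ds) (sym (0≤p⇒∣p∣≡p 0≤XZ-N²)))
    where
    swap : ∀ K ds dbc → dbc * (K * (2ℚ * ds)) ≡ K * (2ℚ * dbc) * ds
    swap = solve-∀ ring
    0≤XZ-N² : 0ℚ ≤ X * Z - N * N
    0≤XZ-N² = subst (0ℚ ≤_) (sym XZ-N²≡k²pmP[2dbc]) (<⇒≤ (*-pos 0<k²pmP (*-pos 0<2 0<dbc)))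

  dac≡dacval : dac ≡ dacval N X Y Z W s ds
  dac≡dacval = trans (x*q≡p*d⇒x≡p⟋q*d (2ℚ * s) (X + Z) ds (<⇒≢0 0<X+Z) (identity k ds b P dac))
    (cong (λ u → ((2ℚ * s) ⟋ u) * ds) (sym (0≤p⇒∣p∣≡p (<⇒≤ 0<X+Z))))
    where
    identity : ∀ k ds b P d → d * (k * (ds + b) * P + k * (ds - b) * P) ≡ 2ℚ * (k * d * P) * ds
    identity = solve-∀ ring

NPC⇒curve : ∀ {a b c dbc dac ds} → NPC a b c dbc dac ds →
  ∃ λ N → ∃ λ X → ∃ λ Y → ∃ λ Z → ∃ λ W → ∃ λ s →
    ValidData N X Y Z W s
    × (a ≡ aval N X Y Z W s ds) × (b ≡ bval N X Y Z W s ds)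
    × (c ≡ cval N X Y Z W s ds) × (dbc ≡ dbcval N X Y Z W s ds)
    × (dac ≡ dacval N X Y Z W s ds)
NPC⇒curve (0<a , 0<b , 0<c , 0<dbc , 0<dac , 0<ds , bc , ac , abc) =
  N , X , Y , Z , W , s , valid , a≡aval , b≡bval , c≡cval , dbc≡dbcval , dac≡dacval
  where open FromNPC 0<a 0<b 0<c 0<dbc 0<dac 0<ds bc ac abc

IsSquare⇒positiveRoot : ∀ {q} → 0ℚ < q → IsSquare q → ∃ λ r → 0ℚ < r × r * r ≡ q
IsSquare⇒positiveRoot {q} 0<q (r , r²≡q) = ∣ r ∣ , 0<∣x∣ r≢0 , trans (∣x∣*∣x∣≡x*x r) r²≡q
  where
  r≢0 : r ≢ 0ℚ
  r≢0 r≡0 = <⇒≢0 0<q (trans (sym r²≡q) (trans (cong (λ u → u * u) r≡0) (*-zeroˡ 0ℚ)))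

PerfectCuboid⇒NPC : ∀ {a b c} → PerfectCuboid a b c → ∃ λ dbc → ∃ λ dac → ∃ λ ds → NPC a b c dbc dac ds
PerfectCuboid⇒NPC {a} {b} {c} (0<a , 0<b , 0<c , _ , □bc , □ac , □abc)
  with IsSquare⇒positiveRoot (+-pos (*-pos 0<b 0<b) (0≤x*x c)) □bc
     | IsSquare⇒positiveRoot (+-pos (*-pos 0<a 0<a) (0≤x*x c)) □ac
     | IsSquare⇒positiveRoot (+-pos (+-pos (*-pos 0<a 0<a) (0≤x*x b)) (0≤x*x c)) □abc
... | dbc , 0<dbc , dbc²≡ | dac , 0<dac , dac²≡ | ds , 0<ds , ds²≡ =
  dbc , dac , ds , 0<a , 0<b , 0<c , 0<dbc , 0<dac , 0<ds , sym dbc²≡ , sym dac²≡ , sym ds²≡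

NPC⇒PerfectCuboid : ∀ {a b c dbc dac ds} → NPC a b c dbc dac ds → IsSquare (a * a + b * b) → PerfectCuboid a b c
NPC⇒PerfectCuboid {dbc = dbc} {dac} {ds} (0<a , 0<b , 0<c , _ , _ , _ , bc , ac , abc) □ab =
  0<a , 0<b , 0<c , □ab , (dbc , sym bc) , (dac , sym ac) , (ds , sym abc)

PerfectCuboid⇒curve : (∃ λ a → ∃ λ b → ∃ λ c → PerfectCuboid a b c) →
  ∃ λ N → ∃ λ X → ∃ λ Y → ∃ λ Z → ∃ λ W → ∃ λ s → ∃ λ ds →
    ValidData N X Y Z W s × (0ℚ < ds) × IsSquare ((1ℚ - tval N X Y Z W * tval N X Y Z W) * (ds * ds))
PerfectCuboid⇒curve (a , b , c , cuboid@(_ , _ , _ , (r , r²≡a²+b²) , _)) with PerfectCuboid⇒NPC cuboid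
... | dbc , dac , ds , (0<a , 0<b , 0<c , 0<dbc , 0<dac , 0<ds , bc , ac , abc) =
  let _ , _ , face = curve⇒cuboid valid 0<ds
  in N , X , Y , Z , W , s , ds , valid , 0<ds ,
     (r , trans r²≡a²+b² (trans (cong₂ (λ u v → u * u + v * v) a≡aval b≡bval) face))
  where open FromNPC 0<a 0<b 0<c 0<dbc 0<dac 0<ds bc ac abc

curve⇒PerfectCuboid : (∃ λ N → ∃ λ X → ∃ λ Y → ∃ λ Z → ∃ λ W → ∃ λ s → ∃ λ ds →
    ValidData N X Y Z W s × (0ℚ < ds) × IsSquare ((1ℚ - tval N X Y Z W * tval N X Y Z W) * (ds * ds))) →
  ∃ λ a → ∃ λ b → ∃ λ c → PerfectCuboid a b c
curve⇒PerfectCuboid (N , X , Y , Z , W , s , ds , valid , 0<ds , □) =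
  let npc , _ , face = curve⇒cuboid valid 0<ds
  in _ , _ , _ , NPC⇒PerfectCuboid npc (subst IsSquare (sym face) □)

theorem4 :
    -- (i)
    (∀ N X Y Z W s ds → ValidData N X Y Z W s → 0ℚ < ds →
      NPC (aval N X Y Z W s ds) (bval N X Y Z W s ds) (cval N X Y Z W s ds)
          (dbcval N X Y Z W s ds) (dacval N X Y Z W s ds) ds
      × (0ℚ ≤ 1ℚ - tval N X Y Z W * tval N X Y Z W)
      × (aval N X Y Z W s ds * aval N X Y Z W s ds
           + bval N X Y Z W s ds * bval N X Y Z W s ds
         ≡ (1ℚ - tval N X Y Z W * tval N X Y Z W) * (ds * ds)))
    -- (ii)
    × (∀ a b c dbc dac ds → NPC a b c dbc dac ds →
      ∃ λ N → ∃ λ X → ∃ λ Y → ∃ λ Z → ∃ λ W → ∃ λ s →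
        ValidData N X Y Z W s
        × (a ≡ aval N X Y Z W s ds) × (b ≡ bval N X Y Z W s ds)
        × (c ≡ cval N X Y Z W s ds) × (dbc ≡ dbcval N X Y Z W s ds)
        × (dac ≡ dacval N X Y Z W s ds))
    -- (iii)
    × ((∃ λ a → ∃ λ b → ∃ λ c → PerfectCuboid a b c) ⇔
       (∃ λ N → ∃ λ X → ∃ λ Y → ∃ λ Z → ∃ λ W → ∃ λ s → ∃ λ ds →
         ValidData N X Y Z W s × (0ℚ < ds)
         × IsSquare ((1ℚ - tval N X Y Z W * tval N X Y Z W) * (ds * ds))))
theorem4 =
  (λ N X Y Z W s ds → curve⇒cuboid) ,
  (λ a b c dbc dac ds → NPC⇒curve) ,
  mk⇔ PerfectCuboid⇒curve curve⇒PerfectCuboid
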